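{- Let $(\mathbb{V},\mathbb{F},+_\mathbb{V},+_\mathbb{F},\times_\mathbb{F},\cdot)$ be a vector space over an infinite field $\mathbb{F}$, with $\mathcal{F}=\{+_\mathbb{V},+_\mathbb{F},\times_\mathbb{F},\cdot\}$. Let $\vec e\in{}^\omega\{0,1\}$ be a sort, $\vec\beta\in{}^\omega\mathbb{F}$, and $v\in\mathbb{V}$ a nonzero vector. Define $\vec b(i)=\vec\beta(i)$ if $\vec e(i)=0$ and $\vec b(i)=\vec\beta(i)\cdot v$ otherwise. If $F\in\mathrm{OT}(\mathcal{F})$ and $\vec b_0=\langle\vec b(i_1),\dots,\vec b(i_n)\rangle$ ($i_1<\dots<i_n$) is a finite subsequence of $\vec b$ such that $F(\bar b_0)$ is defined, and $\bar\beta_0=(\vec\beta(i_1),\dots,\vec\beta(i_n))$, then there is an $n$-ary orderly term $f$ over $\{+_\mathbb{F},\times_\mathbb{F}\}$ such that $F(\bar b_0)=f(\bar\beta_0)$ if the range of $F$ is contained in $\mathbb{F}$, and $F(\bar b_0)=f(\bar\beta_0)\cdot v$ if the range of $F$ is contained in $\mathbb{V}$.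
   Context: The vector space is viewed as an algebra with disjoint phyla $A_0=\mathbb{F}$, $A_1=\mathbb{V}$. For a family $\mathcal{H}$ of operations, orderly terms $\mathrm{OT}(\mathcal{H})$: the smallest collection containing $\mathcal{H}$ and the identity maps of the phyla involved ($\mathrm{id}_\mathbb{F}$, and $\mathrm{id}_\mathbb{V}$ for $\mathcal{F}$), closed under $f(\bar x_1,\dots,\bar x_k)=g(h_1(\bar x_1),\dots,h_k(\bar x_k))$ for $k$-ary $g\in\mathcal{H}$, orderly terms $h_i$ whose codomains match $g$'s arguments, and consecutive disjoint variable blocks $\bar x_i$. -}

module Defs where

open import Level using (Level; _⊔_)
open import Data.Unit using (⊤)
open import Data.Empty using (⊥)
open import Data.Product using (Σ; ∃; _,_; _×_)
open import Data.Nat using (ℕ)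
import Data.Nat as ℕ
open import Data.Fin using (Fin; zero; suc)
import Data.Fin as Fin
open import Data.List using (List; []; _∷_; _++_; replicate)
open import Data.List.Relation.Unary.All using (All; []; _∷_)
open import Data.Vec using (Vec; []; _∷_; lookup; toList)
import Data.Vec as Vec
open import Relation.Nullary using (¬_)
open import Relation.Binary.PropositionalEquality using (_≡_)
open import Algebra.Bundles using (CommutativeRing)
open import Algebra.Module.Bundles using (Module)

-- Phyla (sorts): 0 = 𝔽 (scalars), 1 = 𝕍 (vectors).  A sort ē ∈ ^ω{0,1}
-- is a function ℕ → Sort.

Sort : Set
Sort = Fin 2

φ𝔽 φ𝕍 : Sort
φ𝔽 = zero
φ𝕍 = suc zero

data 𝓕Op : List Sort → Sort → Set where
  +𝕍 : 𝓕Op (φ𝕍 ∷ φ𝕍 ∷ []) φ𝕍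
  +𝔽 : 𝓕Op (φ𝔽 ∷ φ𝔽 ∷ []) φ𝔽
  ×𝔽 : 𝓕Op (φ𝔽 ∷ φ𝔽 ∷ []) φ𝔽
  ·  : 𝓕Op (φ𝔽 ∷ φ𝕍 ∷ []) φ𝕍

data FieldOp : List Sort → Sort → Set where
  +𝔽 : FieldOp (φ𝔽 ∷ φ𝔽 ∷ []) φ𝔽
  ×𝔽 : FieldOp (φ𝔽 ∷ φ𝔽 ∷ []) φ𝔽

-- phyla involved (whose identity maps are included in OT)
All𝓕Phyla : Sort → Set
All𝓕Phyla _ = ⊤

FieldPhyla : Sort → Set
FieldPhyla s = s ≡ φ𝔽

-- Args Op Ph as ins : a tuple of orderly terms h₁,…,h_k whose codomains
-- are  as  and whose (consecutive, disjoint) variable blocks concatenate to ins.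

mutual
  data OT (Op : List Sort → Sort → Set) (Ph : Sort → Set)
          : List Sort → Sort → Set where
    idt : ∀ {s} → Ph s → OT Op Ph (s ∷ []) s
    app : ∀ {as ins s} → Op as s → Args Op Ph as ins → OT Op Ph ins s

  data Args (Op : List Sort → Sort → Set) (Ph : Sort → Set)
          : List Sort → List Sort → Set where
    []  : Args Op Ph [] []
    _∷_ : ∀ {a as ins₁ ins₂} → OT Op Ph ins₁ a → Args Op Ph as ins₂ →
          Args Op Ph (a ∷ as) (ins₁ ++ ins₂)

record IsField {c ℓ} (R : CommutativeRing c ℓ) : Set (c ⊔ ℓ) where
  open CommutativeRing R
  field
    1≉0     : ¬ (1# ≈ 0#)
    inverse : ∀ x → ¬ (x ≈ 0#) → ∃ λ y → x * y ≈ 1#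

Infinite : ∀ {c ℓ} → CommutativeRing c ℓ → Set (c ⊔ ℓ)
Infinite R = ¬ (Σ ℕ λ n → Σ (Fin n → Carrier) λ f → ∀ x → ∃ λ i → f i ≈ x)
  where open CommutativeRing R

StrictlyIncreasing : ∀ {n} → Vec ℕ n → Set
StrictlyIncreasing {n} is = ∀ (j k : Fin n) → j Fin.< k → lookup is j ℕ.< lookup is k

module Semantics {c ℓ m ℓm} (R : CommutativeRing c ℓ) (M : Module R m ℓm) where
  open CommutativeRing R
  open Module M

  data Val : Sort → Set (c ⊔ m) where
    sc : Carrier  → Val φ𝔽
    vc : Carrierᴹ → Val φ𝕍

  ⟦𝓕⟧ : ∀ {as s} → 𝓕Op as s → All Val as → Val s
  ⟦𝓕⟧ +𝕍 (vc x ∷ vc y ∷ []) = vc (x +ᴹ y)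
  ⟦𝓕⟧ +𝔽 (sc x ∷ sc y ∷ []) = sc (x + y)
  ⟦𝓕⟧ ×𝔽 (sc x ∷ sc y ∷ []) = sc (x * y)
  ⟦𝓕⟧ ·  (sc a ∷ vc x ∷ []) = vc (a *ₗ x)

  ⟦Field⟧ : ∀ {as s} → FieldOp as s → All Val as → Val s
  ⟦Field⟧ +𝔽 (sc x ∷ sc y ∷ []) = sc (x + y)
  ⟦Field⟧ ×𝔽 (sc x ∷ sc y ∷ []) = sc (x * y)

  splitAll : ∀ {a} {A : Set a} {P : A → Set (c ⊔ m)} xs {ys} →
             All P (xs ++ ys) → All P xs × All P ys
  splitAll []       ps       = [] , ps
  splitAll (x ∷ xs) (p ∷ ps) with splitAll xs ps
  ... | qs , rs = (p ∷ qs) , rs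

  module Eval {Op : List Sort → Sort → Set} {Ph : Sort → Set}
              (⟦op⟧ : ∀ {as s} → Op as s → All Val as → Val s) where
    mutual
      eval : ∀ {ins s} → OT Op Ph ins s → All Val ins → Val s
      eval (idt _)    (x ∷ []) = x
      eval (app g hs) xs       = ⟦op⟧ g (evalArgs hs xs)

      evalArgs : ∀ {as ins} → Args Op Ph as ins → All Val ins → All Val as
      evalArgs []                 _  = []
      evalArgs (_∷_ {ins₁ = i₁} h hs) xs with splitAll i₁ xs
      ... | ys , zs = eval h ys ∷ evalArgs hs zs

  eval𝓕 : ∀ {ins s} → OT 𝓕Op All𝓕Phyla ins s → All Val ins → Val s
  eval𝓕 = Eval.eval ⟦𝓕⟧

  evalField : ∀ {ins s} → OT FieldOp FieldPhyla ins s → All Val ins → Val s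
  evalField = Eval.eval ⟦Field⟧

  bval : Carrierᴹ → (s : Sort) → Carrier → Val s
  bval v zero          β = sc β
  bval v (suc zero)    β = vc (β *ₗ v)

  sortsOf : (ℕ → Sort) → ∀ {n} → Vec ℕ n → List Sort
  sortsOf e is = toList (Vec.map e is)

  bTuple : (e : ℕ → Sort) (β : ℕ → Carrier) (v : Carrierᴹ) →
           ∀ {n} (is : Vec ℕ n) → All Val (sortsOf e is)
  bTuple e β v []       = []
  bTuple e β v (i ∷ is) = bval v (e i) (β i) ∷ bTuple e β v is

  βTuple : (β : ℕ → Carrier) → ∀ {n} (is : Vec ℕ n) → All Val (replicate n φ𝔽)
  βTuple β []       = []
  βTuple β (i ∷ is) = sc (β i) ∷ βTuple β is

  Matches : Carrierᴹ → ∀ s → Val s → Val φ𝔽 → Set (ℓ ⊔ ℓm)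
  Matches v .φ𝔽 (sc x) (sc y) = Level.Lift (ℓ ⊔ ℓm) (x ≈ y)
  Matches v .φ𝕍 (vc w) (sc y) = Level.Lift (ℓ ⊔ ℓm) (w ≈ᴹ y *ₗ v)

-- Reading every vector w = a · v as its coefficient a turns +_𝕍 into +_𝔽 and
-- · into ×_𝔽, so erasing the sorts of an orderly term over 𝓕 yields an orderly
-- term over {+_𝔽, ×_𝔽} of the same shape.
module Submission where

open import Defs
open import Data.Nat using (ℕ)
open import Data.Vec using (Vec; []; _∷_; toList; map)
open import Data.List using (List; replicate; []; _∷_; _++_)
open import Data.List.Relation.Unary.All using (All; []; _∷_)
open import Data.Product using (∃; Σ; _,_; _×_; proj₁; proj₂)
open import Data.Fin using (zero; suc)
open import Level using (lift; _⊔_)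
open import Relation.Nullary using (¬_)
open import Relation.Binary.PropositionalEquality using (_≡_; refl; subst; sym; cong)
open import Algebra.Bundles using (CommutativeRing)
open import Algebra.Module.Bundles using (Module)

toScalars : List Sort → List Sort
toScalars []       = []
toScalars (_ ∷ ss) = φ𝔽 ∷ toScalars ss

toScalars-++ : ∀ ss ts → toScalars (ss ++ ts) ≡ toScalars ss ++ toScalars ts
toScalars-++ []       ts = refl
toScalars-++ (s ∷ ss) ts = cong (φ𝔽 ∷_) (toScalars-++ ss ts)

scalarOp : ∀ {as s} → 𝓕Op as s → FieldOp (toScalars as) φ𝔽
scalarOp +𝕍 = +𝔽
scalarOp +𝔽 = +𝔽
scalarOp ×𝔽 = ×𝔽
scalarOp ·  = ×𝔽

replicate≡toScalars : ∀ {n} (ss : Vec Sort n) → replicate n φ𝔽 ≡ toScalars (toList ss)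
replicate≡toScalars []       = refl
replicate≡toScalars (s ∷ ss) = cong (φ𝔽 ∷_) (replicate≡toScalars ss)

module Representation {c ℓ m ℓm} (R : CommutativeRing c ℓ) (M : Module R m ℓm)
                      (v : Module.Carrierᴹ M) where
  open CommutativeRing R using (Carrier; _+_; _*_; +-cong; *-cong) renaming (refl to ≈-refl)
  open Module M
  open Semantics R M
  open import Relation.Binary.Reasoning.Setoid ≈ᴹ-setoid

  infixr 5 _∷_
  data _≋_ : ∀ {ins outs} → All Val ins → All Val outs → Set (c ⊔ ℓ ⊔ m ⊔ ℓm) where
    []  : [] ≋ []
    _∷_ : ∀ {s ins outs} {x : Val s} {a : Val φ𝔽} {xs : All Val ins} {as : All Val outs} →
          Matches v s x a → xs ≋ as → (x ∷ xs) ≋ (a ∷ as)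

  splitAll-≋ : ∀ ins₁ {ins₂ outs₂} {xs : All Val (ins₁ ++ ins₂)}
               {as : All Val (toScalars ins₁ ++ outs₂)} → xs ≋ as →
               proj₁ (splitAll ins₁ xs) ≋ proj₁ (splitAll (toScalars ins₁) as) ×
               proj₂ (splitAll ins₁ xs) ≋ proj₂ (splitAll (toScalars ins₁) as)
  splitAll-≋ []        xs≋as = [] , xs≋as
  splitAll-≋ (_ ∷ ins₁) {xs = _ ∷ xs} {as = _ ∷ as} (x≈a ∷ xs≋as)
    with splitAll ins₁ xs | splitAll (toScalars ins₁) as | splitAll-≋ ins₁ xs≋as
  ... | _ , _ | _ , _ | left , right = x≈a ∷ left , right

  scalarOp-sound : ∀ {as s} (g : 𝓕Op as s) {xs : All Val as} {ys} → xs ≋ ys →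
                   Matches v s (⟦𝓕⟧ g xs) (⟦Field⟧ (scalarOp g) ys)
  scalarOp-sound +𝕍 {vc x ∷ vc y ∷ []} {sc a ∷ sc b ∷ []} (lift x≈ ∷ lift y≈ ∷ []) = lift (begin
    x +ᴹ y             ≈⟨ +ᴹ-cong x≈ y≈ ⟩
    a *ₗ v +ᴹ b *ₗ v   ≈⟨ ≈ᴹ-sym (*ₗ-distribʳ v a b) ⟩
    (a + b) *ₗ v       ∎)
  scalarOp-sound +𝔽 {sc x ∷ sc y ∷ []} {sc a ∷ sc b ∷ []} (lift x≈ ∷ lift y≈ ∷ []) = lift (+-cong x≈ y≈)
  scalarOp-sound ×𝔽 {sc x ∷ sc y ∷ []} {sc a ∷ sc b ∷ []} (lift x≈ ∷ lift y≈ ∷ []) = lift (*-cong x≈ y≈)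
  scalarOp-sound ·  {sc x ∷ vc y ∷ []} {sc a ∷ sc b ∷ []} (lift x≈ ∷ lift y≈ ∷ []) = lift (begin
    x *ₗ y             ≈⟨ *ₗ-cong x≈ y≈ ⟩
    a *ₗ (b *ₗ v)      ≈⟨ ≈ᴹ-sym (*ₗ-assoc a b v) ⟩
    (a * b) *ₗ v       ∎)

  Represents : ∀ {ins outs s} → OT 𝓕Op All𝓕Phyla ins s → OT FieldOp FieldPhyla outs φ𝔽 →
               Set (c ⊔ ℓ ⊔ m ⊔ ℓm)
  Represents {s = s} F f = ∀ {xs ys} → xs ≋ ys → Matches v s (eval𝓕 F xs) (evalField f ys)

  mutual
    scalarTerm : ∀ {ins s} (F : OT 𝓕Op All𝓕Phyla ins s) →
                 Σ (OT FieldOp FieldPhyla (toScalars ins) φ𝔽) (Represents F)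
    scalarTerm (idt _)    = idt refl , λ { (x≈a ∷ []) → x≈a }
    scalarTerm (app g hs) with scalarArgs hs
    ... | fs , fs-sound = app (scalarOp g) fs , λ xs≋ys → scalarOp-sound g (fs-sound xs≋ys)

    scalarArgs : ∀ {as ins} (hs : Args 𝓕Op All𝓕Phyla as ins) →
                 Σ (Args FieldOp FieldPhyla (toScalars as) (toScalars ins)) λ fs →
                   ∀ {xs ys} → xs ≋ ys →
                   Eval.evalArgs ⟦𝓕⟧ hs xs ≋ Eval.evalArgs ⟦Field⟧ fs ys
    scalarArgs []  = [] , λ _ → []
    scalarArgs (_∷_ {ins₁ = ins₁} {ins₂ = ins₂} h hs)
      rewrite toScalars-++ ins₁ ins₂
      with scalarTerm h | scalarArgs hs
    ... | f , f-sound | fs , fs-sound = f ∷ fs , sound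
      where
      sound : ∀ {xs ys} → xs ≋ ys →
              Eval.evalArgs ⟦𝓕⟧ (h ∷ hs) xs ≋ Eval.evalArgs ⟦Field⟧ (f ∷ fs) ys
      sound {xs} {ys} xs≋ys
        with splitAll ins₁ xs | splitAll (toScalars ins₁) ys | splitAll-≋ ins₁ xs≋ys
      ... | _ , _ | _ , _ | left , right = f-sound left ∷ fs-sound right

  bTuple≋βTuple : (e : ℕ → Sort) (β : ℕ → Carrier) → ∀ {n} (is : Vec ℕ n) →
                  bTuple e β v is ≋ βTuple β is
  bTuple≋βTuple e β []       = []
  bTuple≋βTuple e β (i ∷ is) with e i
  ... | zero     = lift ≈-refl  ∷ bTuple≋βTuple e β is
  ... | suc zero = lift ≈ᴹ-refl ∷ bTuple≋βTuple e β is

-- Neither the field axioms, nor infinitude, nor v ≉ 0, nor the order of the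
-- indices is needed for this direction.
lemma6p7 : ∀ {c ℓ m ℓm} (R : CommutativeRing c ℓ) (M : Module R m ℓm) →
    IsField R → Infinite R →
    let open Semantics R M
    in (e : ℕ → Sort) (β : ℕ → CommutativeRing.Carrier R) (v : Module.Carrierᴹ M) →
       ¬ (Module._≈ᴹ_ M v (Module.0ᴹ M)) →
       ∀ {ins s} (F : OT 𝓕Op All𝓕Phyla ins s) →
       ∀ n (is : Vec ℕ n) → StrictlyIncreasing is →
       (defined : ins ≡ sortsOf e is) →
       ∃ λ (f : OT FieldOp FieldPhyla (replicate n φ𝔽) φ𝔽) →
         Matches v s (eval𝓕 F (subst (All Val) (sym defined) (bTuple e β v is)))
                     (evalField f (βTuple β is))
lemma6p7 R M _ _ e β v _ F n is _ refl = proj₁ scalarF , proj₂ scalarF (bTuple≋βTuple e β is)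
  where
  open Representation R M v
  scalarF : Σ (OT FieldOp FieldPhyla (replicate n φ𝔽) φ𝔽) (Represents F)
  scalarF = subst (λ outs → Σ (OT FieldOp FieldPhyla outs φ𝔽) (Represents F))
                  (sym (replicate≡toScalars (map e is))) (scalarTerm F)
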